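{- Let $r$ be a complex number and $n\ge1$ an integer. Then, as polynomials in $x$, $$(n+1)d_{n+1}^{(r)}(x)=(1+2x)d_n^{(r)}(x)+(n+2r)d_{n-1}^{(r)}(x).$$
   Context: For a complex number $a$ and integer $k\ge0$, $\binom{a}{k}=a(a-1)\cdots(a-k+1)/k!$. For a parameter $r$ and an integer $n\ge 0$, $d_n^{(r)}(x)=\sum_{k=0}^n\binom{x+r+k}{k}\binom{x-r}{n-k}$. -}

module Defs where

open import Algebra.Bundles using (CommutativeRing)
open import Data.Nat using (ℕ; zero; suc; _∸_)

-- Everything is stated over an arbitrary commutative ring R in which every
-- positive integer is invertible (e.g. ℂ, or the polynomial ring ℂ[x]).
-- `inv n` is the chosen inverse of the integer n+1.
module _ {c ℓ} (R : CommutativeRing c ℓ) where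
  open CommutativeRing R hiding (zero)

  ι : ℕ → Carrier
  ι zero = 0#
  ι (suc n) = 1# + ι n

  falling : Carrier → ℕ → Carrier
  falling a zero = 1#
  falling a (suc k) = falling a k * (a - ι k)

  invFact : (ℕ → Carrier) → ℕ → Carrier
  invFact inv zero = 1#
  invFact inv (suc k) = invFact inv k * inv k

  binom : (ℕ → Carrier) → Carrier → ℕ → Carrier
  binom inv a k = falling a k * invFact inv k

  sumTo : ℕ → (ℕ → Carrier) → Carrier
  sumTo zero f = f 0
  sumTo (suc n) f = sumTo n f + f (suc n)

  d : (ℕ → Carrier) → Carrier → ℕ → Carrier → Carrier
  d inv r n x = sumTo n (λ k → binom inv (x + r + ι k) k * binom inv (x - r) (n ∸ k))

module Submission where

-- Write d_n = Σ_k A_k B_(n-k) with A_k = binom(x+r+k, k) and B_j = binom(x-r, j). With a = x+r+1 and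
-- b = x-r the factors satisfy (k+1) A_(k+1) = (a+k) A_k and (j+1) B_(j+1) = (b-j) B_j. Splitting the
-- weight n = k + (n-k) in n d_n and shifting each half by the matching recurrence gives
-- L_(n+1) = a d_n + L_n and W_(n+1) = b d_n - W_n for the two weighted sums; combining these at n+1
-- and at n yields (n+2) d_(n+2) = (a+b) d_(n+1) + (a-b+n) d_n.

open import Defs
open import Algebra.Bundles using (CommutativeRing)
open import Data.Nat as ℕ using (ℕ; zero; suc; _≤_; _∸_; z≤n)
import Data.Nat.Properties as ℕ
open import Data.Integer as ℤ using (ℤ; +_; -[1+_])
import Data.Integer.Properties as ℤ
open import Data.Maybe using (Maybe; just; nothing)
open import Relation.Nullary using (yes; no)
import Relation.Binary.PropositionalEquality as ≡
import Algebra.Solver.Ring.AlmostCommutativeRing as ACR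

-- Integer rather than R-valued coefficients make coefficient equality decidable, so the solver
-- can normalise cancellations such as (x + r) + (x - r) = 2x.
module IntegerRingSolver {c ℓ} (R : CommutativeRing c ℓ) where
  open CommutativeRing R hiding (zero)
  open import Algebra.Properties.Ring ring using (-0#≈0#; -‿involutive; -‿+-comm; -‿distribˡ-*; -‿distribʳ-*)
  open import Algebra.Properties.CommutativeSemigroup +-commutativeSemigroup using (interchange)
  open import Relation.Binary.Reasoning.Setoid setoid

  ι-homo-+ : ∀ m n → ι R (m ℕ.+ n) ≈ ι R m + ι R n
  ι-homo-+ zero    n = sym (+-identityˡ (ι R n))
  ι-homo-+ (suc m) n = trans (+-congˡ (ι-homo-+ m n)) (sym (+-assoc 1# (ι R m) (ι R n)))

  ι-homo-* : ∀ m n → ι R (m ℕ.* n) ≈ ι R m * ι R n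
  ι-homo-* zero    n = sym (zeroˡ (ι R n))
  ι-homo-* (suc m) n = begin
    ι R (n ℕ.+ m ℕ.* n)         ≈⟨ ι-homo-+ n (m ℕ.* n) ⟩
    ι R n + ι R (m ℕ.* n)       ≈⟨ +-cong (sym (*-identityˡ (ι R n))) (ι-homo-* m n) ⟩
    1# * ι R n + ι R m * ι R n  ≈⟨ sym (distribʳ (ι R n) 1# (ι R m)) ⟩
    (1# + ι R m) * ι R n        ∎

  fromℤ : ℤ → Carrier
  fromℤ (+ n)      = ι R n
  fromℤ -[1+ n ]   = - ι R (suc n)

  fromℤ-⊖ : ∀ m n → fromℤ (m ℤ.⊖ n) ≈ ι R m - ι R n
  fromℤ-⊖ m       zero    = begin
    fromℤ (m ℤ.⊖ 0)  ≡⟨ ≡.cong fromℤ (ℤ.⊖-≥ {m} z≤n) ⟩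
    ι R m            ≈⟨ sym (+-identityʳ (ι R m)) ⟩
    ι R m + 0#       ≈⟨ +-congˡ (sym -0#≈0#) ⟩
    ι R m - 0#       ∎
  fromℤ-⊖ zero    (suc n) = sym (+-identityˡ _)
  fromℤ-⊖ (suc m) (suc n) = begin
    fromℤ (suc m ℤ.⊖ suc n)        ≡⟨ ≡.cong fromℤ (ℤ.[1+m]⊖[1+n]≡m⊖n m n) ⟩
    fromℤ (m ℤ.⊖ n)                ≈⟨ fromℤ-⊖ m n ⟩
    ι R m - ι R n                  ≈⟨ sym (+-identityˡ _) ⟩
    0# + (ι R m - ι R n)           ≈⟨ +-congʳ (sym (-‿inverseʳ 1#)) ⟩
    (1# - 1#) + (ι R m - ι R n)    ≈⟨ interchange 1# (- 1#) (ι R m) (- ι R n) ⟩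
    (1# + ι R m) + (- 1# - ι R n)  ≈⟨ +-congˡ (-‿+-comm 1# (ι R n)) ⟩
    ι R (suc m) - ι R (suc n)      ∎

  fromℤ-homo-+ : ∀ i j → fromℤ (i ℤ.+ j) ≈ fromℤ i + fromℤ j
  fromℤ-homo-+ (+ m)    (+ n)    = ι-homo-+ m n
  fromℤ-homo-+ (+ m)    -[1+ n ] = fromℤ-⊖ m (suc n)
  fromℤ-homo-+ -[1+ m ] (+ n)    = trans (fromℤ-⊖ n (suc m)) (+-comm _ _)
  fromℤ-homo-+ -[1+ m ] -[1+ n ] = begin
    - ι R (suc (suc (m ℕ.+ n)))      ≡⟨ ≡.cong (λ k → - ι R (suc k)) (ℕ.+-suc m n) ⟨
    - ι R (suc m ℕ.+ suc n)          ≈⟨ -‿cong (ι-homo-+ (suc m) (suc n)) ⟩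
    - (ι R (suc m) + ι R (suc n))    ≈⟨ -‿+-comm _ _ ⟨
    - ι R (suc m) - ι R (suc n)      ∎

  fromℤ-homo-* : ∀ i j → fromℤ (i ℤ.* j) ≈ fromℤ i * fromℤ j
  fromℤ-homo-* (+ m)          (+ n)          =
    trans (reflexive (≡.cong fromℤ (ℤ.+◃n≡+n (m ℕ.* n)))) (ι-homo-* m n)
  fromℤ-homo-* (+ zero)       -[1+ n ]       = sym (zeroˡ _)
  fromℤ-homo-* (+ suc m)      -[1+ n ]       =
    trans (-‿cong (ι-homo-* (suc m) (suc n))) (-‿distribʳ-* _ _)
  fromℤ-homo-* -[1+ m ]       (+ zero)       =
    trans (reflexive (≡.cong fromℤ (ℤ.*-zeroʳ -[1+ m ]))) (sym (zeroʳ _))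
  fromℤ-homo-* -[1+ m ]       (+ suc n)      =
    trans (-‿cong (ι-homo-* (suc m) (suc n))) (-‿distribˡ-* _ _)
  fromℤ-homo-* -[1+ m ]       -[1+ n ]       = begin
    ι R (suc m ℕ.* suc n)                ≈⟨ ι-homo-* (suc m) (suc n) ⟩
    ι R (suc m) * ι R (suc n)            ≈⟨ -‿involutive _ ⟨
    - - (ι R (suc m) * ι R (suc n))      ≈⟨ -‿cong (-‿distribʳ-* _ _) ⟩
    - (ι R (suc m) * - ι R (suc n))      ≈⟨ -‿distribˡ-* _ _ ⟩
    - ι R (suc m) * - ι R (suc n)        ∎

  fromℤ-homo-neg : ∀ i → fromℤ (ℤ.- i) ≈ - fromℤ i
  fromℤ-homo-neg (+ zero)  = sym -0#≈0#
  fromℤ-homo-neg (+ suc n) = refl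
  fromℤ-homo-neg -[1+ n ]  = sym (-‿involutive _)

  fromℤ-homomorphism : ℤ.+-*-rawRing ACR.-Raw-AlmostCommutative⟶ ACR.fromCommutativeRing R
  fromℤ-homomorphism = record
    { ⟦_⟧    = fromℤ
    ; +-homo = fromℤ-homo-+
    ; *-homo = fromℤ-homo-*
    ; -‿homo = fromℤ-homo-neg
    ; 0-homo = refl
    ; 1-homo = +-identityʳ 1#
    }

  fromℤ-≟ : ∀ i j → Maybe (fromℤ i ≈ fromℤ j)
  fromℤ-≟ i j with i ℤ.≟ j
  ... | yes ≡.refl = just refl
  ... | no _       = nothing

  open import Algebra.Solver.Ring ℤ.+-*-rawRing (ACR.fromCommutativeRing R) fromℤ-homomorphism fromℤ-≟ public

module SumTo {c ℓ} (R : CommutativeRing c ℓ) where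
  open CommutativeRing R hiding (zero)
  open import Algebra.Properties.Ring ring using (-‿+-comm)
  open import Algebra.Properties.CommutativeSemigroup +-commutativeSemigroup using (interchange)

  sumTo-cong : ∀ n {f g : ℕ → Carrier} → (∀ k → k ≤ n → f k ≈ g k) → sumTo R n f ≈ sumTo R n g
  sumTo-cong zero    f≈g = f≈g 0 z≤n
  sumTo-cong (suc n) f≈g =
    +-cong (sumTo-cong n (λ k k≤n → f≈g k (ℕ.m≤n⇒m≤1+n k≤n))) (f≈g (suc n) ℕ.≤-refl)

  sumTo-+ : ∀ n (f g : ℕ → Carrier) → sumTo R n (λ k → f k + g k) ≈ sumTo R n f + sumTo R n g
  sumTo-+ zero    f g = refl
  sumTo-+ (suc n) f g = trans (+-congʳ (sumTo-+ n f g)) (interchange _ _ _ _)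

  sumTo-*ˡ : ∀ n a (f : ℕ → Carrier) → sumTo R n (λ k → a * f k) ≈ a * sumTo R n f
  sumTo-*ˡ zero    a f = refl
  sumTo-*ˡ (suc n) a f = trans (+-congʳ (sumTo-*ˡ n a f)) (sym (distribˡ a _ _))

  sumTo-neg : ∀ n (f : ℕ → Carrier) → sumTo R n (λ k → - f k) ≈ - sumTo R n f
  sumTo-neg zero    f = refl
  sumTo-neg (suc n) f = trans (+-congʳ (sumTo-neg n f)) (-‿+-comm _ _)

  sumTo-suc-shift : ∀ n (f : ℕ → Carrier) → sumTo R (suc n) f ≈ f 0 + sumTo R n (λ k → f (suc k))
  sumTo-suc-shift zero    f = refl
  sumTo-suc-shift (suc n) f = trans (+-congʳ (sumTo-suc-shift n f)) (+-assoc _ _ _)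

module _ {c ℓ} (R : CommutativeRing c ℓ) where
  open CommutativeRing R hiding (zero)

  module Binomial (inv : ℕ → Carrier) (inv-correct : ∀ m → ι R (suc m) * inv m ≈ 1#) where
    open import Algebra.Properties.Ring ring using (-0#≈0#)
    open import Relation.Binary.Reasoning.Setoid setoid
    open IntegerRingSolver R using (solve; _:=_; _:+_; _:-_; _:*_)

    falling-cong : ∀ {y z} k → y ≈ z → falling R y k ≈ falling R z k
    falling-cong zero    y≈z = refl
    falling-cong (suc k) y≈z = *-cong (falling-cong k y≈z) (+-congʳ y≈z)

    falling-suc-shift : ∀ y k → falling R (y + 1#) (suc k) ≈ (y + 1#) * falling R y k
    falling-suc-shift y zero    = begin
      1# * (y + 1# - 0#)   ≈⟨ *-identityˡ _ ⟩
      y + 1# - 0#          ≈⟨ +-congˡ -0#≈0# ⟩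
      y + 1# + 0#          ≈⟨ +-identityʳ _ ⟩
      y + 1#               ≈⟨ *-identityʳ _ ⟨
      (y + 1#) * 1#        ∎
    falling-suc-shift y (suc k) = begin
      falling R (y + 1#) (suc k) * (y + 1# - ι R (suc k))  ≈⟨ *-congʳ (falling-suc-shift y k) ⟩
      (y + 1#) * F * (y + 1# - (1# + ι R k))
        ≈⟨ solve 4 (λ y F t o → (y :+ o) :* F :* (y :+ o :- (o :+ t)) := (y :+ o) :* (F :* (y :- t))) refl y F (ι R k) 1# ⟩
      (y + 1#) * (F * (y - ι R k))                         ∎
      where
      F : Carrier
      F = falling R y k

    binom-cong : ∀ {y z} k → y ≈ z → binom R inv y k ≈ binom R inv z k
    binom-cong k y≈z = *-congʳ (falling-cong k y≈z)

    ι-suc-*-invFact-suc : ∀ k u → ι R (suc k) * (u * invFact R inv (suc k)) ≈ u * invFact R inv k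
    ι-suc-*-invFact-suc k u = begin
      ι R (suc k) * (u * (I * inv k))  ≈⟨ solve 4 (λ S u I J → S :* (u :* (I :* J)) := u :* I :* (S :* J)) refl (ι R (suc k)) u I (inv k) ⟩
      u * I * (ι R (suc k) * inv k)    ≈⟨ *-congˡ (inv-correct k) ⟩
      u * I * 1#                       ≈⟨ *-identityʳ _ ⟩
      u * I                            ∎
      where
      I : Carrier
      I = invFact R inv k

    binom-rec : ∀ y k → ι R (suc k) * binom R inv y (suc k) ≈ (y - ι R k) * binom R inv y k
    binom-rec y k = begin
      ι R (suc k) * (falling R y k * (y - ι R k) * invFact R inv (suc k))
        ≈⟨ ι-suc-*-invFact-suc k _ ⟩
      falling R y k * (y - ι R k) * invFact R inv k
        ≈⟨ solve 3 (λ F s I → F :* s :* I := s :* (F :* I)) refl _ _ _ ⟩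
      (y - ι R k) * binom R inv y k ∎

    binom-absorb : ∀ y k → ι R (suc k) * binom R inv (y + 1#) (suc k) ≈ (y + 1#) * binom R inv y k
    binom-absorb y k = begin
      ι R (suc k) * (falling R (y + 1#) (suc k) * invFact R inv (suc k))
        ≈⟨ *-congˡ (*-congʳ (falling-suc-shift y k)) ⟩
      ι R (suc k) * ((y + 1#) * falling R y k * invFact R inv (suc k))
        ≈⟨ ι-suc-*-invFact-suc k _ ⟩
      (y + 1#) * falling R y k * invFact R inv k
        ≈⟨ *-assoc _ _ _ ⟩
      (y + 1#) * binom R inv y k ∎

    binom-+ι-rec : ∀ z k → ι R (suc k) * binom R inv (z + ι R (suc k)) (suc k)
                             ≈ (z + 1# + ι R k) * binom R inv (z + ι R k) k
    binom-+ι-rec z k = begin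
      ι R (suc k) * binom R inv (z + (1# + ι R k)) (suc k)
        ≈⟨ *-congˡ (binom-cong (suc k) (solve 3 (λ z o t → z :+ (o :+ t) := (z :+ t) :+ o) refl z 1# (ι R k))) ⟩
      ι R (suc k) * binom R inv ((z + ι R k) + 1#) (suc k)
        ≈⟨ binom-absorb (z + ι R k) k ⟩
      ((z + ι R k) + 1#) * binom R inv (z + ι R k) k
        ≈⟨ *-congʳ (solve 3 (λ z o t → (z :+ t) :+ o := z :+ o :+ t) refl z 1# (ι R k)) ⟩
      (z + 1# + ι R k) * binom R inv (z + ι R k) k ∎

  module Convolution (A B : ℕ → Carrier) (a b : Carrier)
                     (A-rec : ∀ k → ι R (suc k) * A (suc k) ≈ (a + ι R k) * A k)
                     (B-rec : ∀ j → ι R (suc j) * B (suc j) ≈ (b - ι R j) * B j) where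
    open import Relation.Binary.Reasoning.Setoid setoid
    open IntegerRingSolver R using (ι-homo-+; solve; _:=_; _:+_; _:-_; _:*_)
    open SumTo R

    conv : ℕ → Carrier
    conv n = sumTo R n (λ k → A k * B (n ∸ k))

    leftWeighted : ℕ → Carrier
    leftWeighted n = sumTo R n (λ k → ι R k * (A k * B (n ∸ k)))

    rightWeighted : ℕ → Carrier
    rightWeighted n = sumTo R n (λ k → ι R (n ∸ k) * (A k * B (n ∸ k)))

    ι-*-conv : ∀ n → ι R n * conv n ≈ leftWeighted n + rightWeighted n
    ι-*-conv n = begin
      ι R n * conv n                                         ≈⟨ sumTo-*ˡ n (ι R n) _ ⟨
      sumTo R n (λ k → ι R n * (A k * B (n ∸ k)))            ≈⟨ sumTo-cong n split ⟩
      sumTo R n (λ k → ι R k * (A k * B (n ∸ k)) + ι R (n ∸ k) * (A k * B (n ∸ k)))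
                                                             ≈⟨ sumTo-+ n _ _ ⟩
      leftWeighted n + rightWeighted n                       ∎
      where
      split : ∀ k → k ≤ n → ι R n * (A k * B (n ∸ k)) ≈ ι R k * (A k * B (n ∸ k)) + ι R (n ∸ k) * (A k * B (n ∸ k))
      split k k≤n = begin
        ι R n * (A k * B (n ∸ k))                  ≡⟨ ≡.cong (λ m → ι R m * (A k * B (n ∸ k))) (ℕ.m+[n∸m]≡n k≤n) ⟨
        ι R (k ℕ.+ (n ∸ k)) * (A k * B (n ∸ k))    ≈⟨ *-congʳ (ι-homo-+ k (n ∸ k)) ⟩
        (ι R k + ι R (n ∸ k)) * (A k * B (n ∸ k))  ≈⟨ distribʳ _ _ _ ⟩
        ι R k * (A k * B (n ∸ k)) + ι R (n ∸ k) * (A k * B (n ∸ k)) ∎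

    leftWeighted-suc : ∀ n → leftWeighted (suc n) ≈ a * conv n + leftWeighted n
    leftWeighted-suc n = begin
      leftWeighted (suc n)
        ≈⟨ sumTo-suc-shift n _ ⟩
      0# * (A 0 * B (suc n)) + sumTo R n (λ k → ι R (suc k) * (A (suc k) * B (n ∸ k)))
        ≈⟨ +-cong (zeroˡ _) (sumTo-cong n (λ k _ → shift k)) ⟩
      0# + sumTo R n (λ k → a * (A k * B (n ∸ k)) + ι R k * (A k * B (n ∸ k)))
        ≈⟨ +-identityˡ _ ⟩
      sumTo R n (λ k → a * (A k * B (n ∸ k)) + ι R k * (A k * B (n ∸ k)))
        ≈⟨ sumTo-+ n _ _ ⟩
      sumTo R n (λ k → a * (A k * B (n ∸ k))) + leftWeighted n
        ≈⟨ +-congʳ (sumTo-*ˡ n a _) ⟩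
      a * conv n + leftWeighted n ∎
      where
      shift : ∀ k → ι R (suc k) * (A (suc k) * B (n ∸ k)) ≈ a * (A k * B (n ∸ k)) + ι R k * (A k * B (n ∸ k))
      shift k = begin
        ι R (suc k) * (A (suc k) * B (n ∸ k))  ≈⟨ *-assoc _ _ _ ⟨
        ι R (suc k) * A (suc k) * B (n ∸ k)    ≈⟨ *-congʳ (A-rec k) ⟩
        (a + ι R k) * A k * B (n ∸ k)          ≈⟨ solve 4 (λ a t u v → (a :+ t) :* u :* v := a :* (u :* v) :+ t :* (u :* v)) refl a (ι R k) (A k) (B (n ∸ k)) ⟩
        a * (A k * B (n ∸ k)) + ι R k * (A k * B (n ∸ k)) ∎

    rightWeighted-suc : ∀ n → rightWeighted (suc n) ≈ b * conv n - rightWeighted n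
    rightWeighted-suc n = begin
      rightWeighted (suc n)
        ≈⟨ +-cong (sumTo-cong n shift) (trans (*-congʳ (reflexive (≡.cong (ι R) (ℕ.n∸n≡0 n)))) (zeroˡ _)) ⟩
      sumTo R n (λ k → b * (A k * B (n ∸ k)) - ι R (n ∸ k) * (A k * B (n ∸ k))) + 0#
        ≈⟨ +-identityʳ _ ⟩
      sumTo R n (λ k → b * (A k * B (n ∸ k)) - ι R (n ∸ k) * (A k * B (n ∸ k)))
        ≈⟨ sumTo-+ n _ _ ⟩
      sumTo R n (λ k → b * (A k * B (n ∸ k))) + sumTo R n (λ k → - (ι R (n ∸ k) * (A k * B (n ∸ k))))
        ≈⟨ +-cong (sumTo-*ˡ n b _) (sumTo-neg n _) ⟩
      b * conv n - rightWeighted n ∎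
      where
      shift : ∀ k → k ≤ n → ι R (suc n ∸ k) * (A k * B (suc n ∸ k))
                              ≈ b * (A k * B (n ∸ k)) - ι R (n ∸ k) * (A k * B (n ∸ k))
      shift k k≤n = begin
        ι R (suc n ∸ k) * (A k * B (suc n ∸ k))  ≡⟨ ≡.cong (λ j → ι R j * (A k * B j)) (ℕ.+-∸-assoc 1 k≤n) ⟩
        ι R (suc j) * (A k * B (suc j))          ≈⟨ solve 3 (λ S u v → S :* (u :* v) := u :* (S :* v)) refl (ι R (suc j)) (A k) (B (suc j)) ⟩
        A k * (ι R (suc j) * B (suc j))          ≈⟨ *-congˡ (B-rec j) ⟩
        A k * ((b - ι R j) * B j)                ≈⟨ solve 4 (λ u b t v → u :* ((b :- t) :* v) := b :* (u :* v) :- t :* (u :* v)) refl (A k) b (ι R j) (B j) ⟩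
        b * (A k * B j) - ι R j * (A k * B j)    ∎
        where
        j : ℕ
        j = n ∸ k

    conv-rec : ∀ n → ι R (suc (suc n)) * conv (suc (suc n))
                       ≈ (a + b) * conv (suc n) + (a - b + ι R n) * conv n
    conv-rec n = begin
      ι R (suc (suc n)) * conv (suc (suc n))
        ≈⟨ ι-*-conv (suc (suc n)) ⟩
      leftWeighted (suc (suc n)) + rightWeighted (suc (suc n))
        ≈⟨ +-cong (trans (leftWeighted-suc (suc n)) (+-congˡ (leftWeighted-suc n)))
                  (trans (rightWeighted-suc (suc n)) (+-congˡ (-‿cong (rightWeighted-suc n)))) ⟩
      (a * c₁ + (a * c₀ + L)) + (b * c₁ - (b * c₀ - W))
        ≈⟨ solve 6 (λ a b c₁ c₀ L W → (a :* c₁ :+ (a :* c₀ :+ L)) :+ (b :* c₁ :- (b :* c₀ :- W))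
                                      := (a :+ b) :* c₁ :+ ((a :- b) :* c₀ :+ (L :+ W))) refl a b c₁ c₀ L W ⟩
      (a + b) * c₁ + ((a - b) * c₀ + (L + W))
        ≈⟨ +-congˡ (+-congˡ (ι-*-conv n)) ⟨
      (a + b) * c₁ + ((a - b) * c₀ + ι R n * c₀)
        ≈⟨ +-congˡ (distribʳ c₀ (a - b) (ι R n)) ⟨
      (a + b) * c₁ + (a - b + ι R n) * c₀ ∎
      where
      c₁ c₀ L W : Carrier
      c₁ = conv (suc n)
      c₀ = conv n
      L = leftWeighted n
      W = rightWeighted n

theorem2p2 : ∀ {c ℓ} (R : CommutativeRing c ℓ) → let open CommutativeRing R in
    (inv : ℕ → Carrier) → (∀ m → ι R (suc m) * inv m ≈ 1#) →
    ∀ (r x : Carrier) (n : ℕ) → 1 ≤ n →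
    ι R (suc n) * d R inv r (suc n) x
    ≈ (1# + ι R 2 * x) * d R inv r n x + (ι R n + ι R 2 * r) * d R inv r (n ∸ 1) x
theorem2p2 R inv inv-correct r x (suc m) _ = begin
  ι R (suc (suc m)) * conv (suc (suc m))       ≈⟨ conv-rec m ⟩
  (a + b) * conv (suc m) + (a - b + ι R m) * conv m
    ≈⟨ +-cong (*-congʳ a+b≈1+2x) (*-congʳ a-b+m≈1+m+2r) ⟩
  (1# + ι R 2 * x) * conv (suc m) + (ι R (suc m) + ι R 2 * r) * conv m ∎
  where
  open CommutativeRing R hiding (zero)
  open import Relation.Binary.Reasoning.Setoid setoid
  open IntegerRingSolver R using (solve; _:=_; _:+_; _:-_; _:*_; con)
  open Binomial R inv inv-correct using (binom-rec; binom-+ι-rec)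
  a b : Carrier
  a = x + r + 1#
  b = x - r

  -- 1# enters as a variable: the constant con (+ 1) denotes ι R 1 = 1# + 0#, not 1#.
  a+b≈1+2x : a + b ≈ 1# + ι R 2 * x
  a+b≈1+2x = solve 3 (λ x r o → x :+ r :+ o :+ (x :- r) := o :+ con (+ 2) :* x) refl x r 1#

  a-b+m≈1+m+2r : a - b + ι R m ≈ ι R (suc m) + ι R 2 * r
  a-b+m≈1+m+2r = solve 4 (λ x r o t → x :+ r :+ o :- (x :- r) :+ t := o :+ t :+ con (+ 2) :* r) refl x r 1# (ι R m)

  A : ℕ → Carrier
  A k = binom R inv (x + r + ι R k) k
  open Convolution R A (binom R inv b) a b (binom-+ι-rec (x + r)) (binom-rec b)
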